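{- Let $c$ be an integer constant and $h(x)=x+c$. Let $n>0$ and $k>0$ with $k+c\ge 0$. Then the $h$-load process in the interval $(k,k+n]$ with $(\alpha,\beta,\gamma)$ ends with $\gamma=n\cdot 2^{ -k-c}$.
   Context: Binary digit positions are numbered $1,2,3,\dots$ after the binary point, position $i$ having weight $2^{ -i}$; $x(i)$ denotes the digit of $x$ at position $i$. For a function $h$ and integers $t$, $n>0$, the $h$-load process in $(t-n,t]$ with $(\alpha,\beta,\gamma)$ is the following deterministic procedure. Start with $\alpha=\beta=\gamma=0$. At stages $s=1,2,3,\dots$, repeat until $\alpha(i)=\beta(i)=1$ for all $i\in(t-n,t]$: if $s$ is odd, replace $\alpha$ by $\alpha+2^{ -t}$ and let $k'$ be the leftmost position at which a digit of $\alpha$ changes; if $s$ is even, do the same with $\beta$ in place of $\alpha$. Then add to $\gamma$ the least amount which changes a digit of $\gamma$ at a position $\le h(k')$, i.e.\ replace $\gamma$ by $(\lfloor 2^{h(k')}\gamma\rfloor+1)\cdot 2^{ -h(k')}$. -}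

module Defs where

open import Data.Nat as ℕ using (ℕ; zero; suc; _∸_; _<_; _≤_)
open import Data.Nat.Properties using (m^n≢0)
open import Data.Bool using (Bool; true; false; if_then_else_)
open import Data.Integer as ℤ using (ℤ; +_; -[1+_]; _%ℕ_)
open import Data.Rational as ℚ using (ℚ; floor; _/_)
open import Data.Product using (Σ; _×_; ∃-syntax)
open import Relation.Binary.PropositionalEquality using (_≡_)
open import Relation.Nullary using (¬_; does)

pow2 : ℤ → ℚ
pow2 (+ m)     = (+ (2 ℕ.^ m)) / 1
pow2 -[1+ m ]  = (+ 1) / (2 ℕ.^ suc m)
  where instance _ = m^n≢0 2 (suc m)

digit : ℚ → ℕ → ℕ
digit x i = floor (pow2 (+ i) ℚ.* x) %ℕ 2

leftmostDiff : ℚ → ℚ → ℕ → ℕ → ℕ → ℕ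
leftmostDiff x y t lo zero    = t
leftmostDiff x y t lo (suc m) =
  if does (digit x lo ℕ.≟ digit y lo) then leftmostDiff x y t (suc lo) m else lo

leftmostChange : ℚ → ℚ → ℕ → ℕ
leftmostChange x y t = leftmostDiff x y t 1 t

record State : Set where
  constructor ⟨_,_,_⟩
  field
    α β γ : ℚ
open State public

-- least increase of γ changing a digit of γ at a position ≤ p:
-- γ ↦ (⌊2^p γ⌋ + 1) · 2^{-p}
bumpγ : ℤ → ℚ → ℚ
bumpγ p g = ((floor (pow2 p ℚ.* g) ℤ.+ + 1) / 1) ℚ.* pow2 (ℤ.- p)

isEven : ℕ → Bool
isEven zero = true
isEven (suc zero) = false
isEven (suc (suc s)) = isEven s

-- state after `s` stages of the h-load process in (t-n, t]
-- (stage number s+1 is odd iff s is even; odd stages update α)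
loadRun : (ℕ → ℤ) → (t : ℕ) → ℕ → State
loadRun h t zero = ⟨ ℚ.0ℚ , ℚ.0ℚ , ℚ.0ℚ ⟩
loadRun h t (suc s) with loadRun h t s | isEven s
... | ⟨ a , b , g ⟩ | true  =
  let a' = a ℚ.+ pow2 (ℤ.- (+ t)) in
  ⟨ a' , b , bumpγ (h (leftmostChange a a' t)) g ⟩
... | ⟨ a , b , g ⟩ | false =
  let b' = b ℚ.+ pow2 (ℤ.- (+ t)) in
  ⟨ a , b' , bumpγ (h (leftmostChange b b' t)) g ⟩

Done : (t n : ℕ) → State → Set
Done t n st = ∀ i → 1 ≤ i → t ∸ n < i → i ≤ t →
  (digit (α st) i ≡ 1) × (digit (β st) i ≡ 1)

LoadEndsWith : (h : ℕ → ℤ) (t n : ℕ) → ℚ → Set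
LoadEndsWith h t n v = ∃[ s ] (Done t n (loadRun h t s)
  × (∀ s' → s' < s → ¬ Done t n (loadRun h t s'))
  × γ (loadRun h t s) ≡ v)

-- Both registers hold multiples of 2^-t, t = k + n, and after 2q stages α = β = q·2^-t.  Loading a register
-- that holds a·2^-t, where a ends in a zero followed by exactly v ones, flips its digits at positions t-v, ..., t,
-- so the leftmost change is at t - v and γ is raised to the next multiple of 2^-(k+c+n-v).  As long as γ is a
-- multiple of 2^v·2^-(k+c+n), this adds exactly 2^v·2^-(k+c+n).  Divisibility is preserved through a block of
-- 2^j - 1 consecutive double loads starting at a multiple of 2^j, and by induction on j such a block adds
-- j·2^j·2^-(k+c+n) to γ.  The process stops at the first q whose low n bits are all 1, namely q = 2^n - 1, after
-- the block with j = n, so γ = n·2^n·2^-(k+c+n) = n·2^-(k+c).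
module Submission where

open import Defs
open import Data.Nat using (ℕ; _+_; _>_)
open import Data.Integer as ℤ using (ℤ; +_)
open import Data.Rational as ℚ using (_/_)

open import Data.Bool using (true; false; if_then_else_)
open import Data.Empty using (⊥-elim)
import Data.Integer.Properties as ℤ
import Data.Integer.Tactic.RingSolver as ℤ-Solver
open import Data.Nat as ℕ using (zero; suc; _*_; _∸_; _^_; _≤_; _<_; z≤n; s≤s; NonZero)
open import Data.Nat.Divisibility using (_∣_; divides-refl; _∣0; n∣m*n; ∣-refl; ∣-trans; ∣m∣n⇒∣m+n)
open import Data.Nat.DivMod
  using (_%_; m*n/m*o≡n/o; m*n/o*n≡m/o; m/n/o≡m/[n*o]; n/1≡n; /-congˡ; /-congʳ; +-distrib-/-∣ʳ;
         m<n⇒m/n≡0; m*n/n≡m; [m+kn]%n≡m%n; m≡m%n+[m/n]*n)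
open import Data.Nat.Properties
open import Data.Nat.Tactic.RingSolver using (solve-∀)
open import Data.Product using (_×_; _,_; proj₁; proj₂; ∃-syntax)
open import Data.Rational using (ℚ; mkℚ)
import Data.Rational.Properties as ℚ
open import Data.Rational.Unnormalised as ℚᵘ using (mkℚᵘ; *≡*) renaming (_/_ to _/ᵘ_; _≃_ to _≃ᵘ_)
import Data.Rational.Unnormalised.Properties as ℚᵘ
open import Data.Sum using (_⊎_; inj₁; inj₂)
open import Function using (_∘_)
open import Relation.Binary.PropositionalEquality
open import Relation.Nullary using (¬_; Dec; does; yes; no)

toℚᵘ-/ : ∀ i d .{{_ : NonZero d}} → ℚ.toℚᵘ (i / d) ≃ᵘ (i /ᵘ d)
toℚᵘ-/ i (suc d) = ℚ.toℚᵘ-fromℚᵘ (mkℚᵘ i d)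

≃ᵘ⇒/≡/ : ∀ i j b d .{{_ : NonZero b}} .{{_ : NonZero d}} →
                 (i /ᵘ b) ≃ᵘ (j /ᵘ d) → i / b ≡ j / d
≃ᵘ⇒/≡/ i j b d eq =
  ℚ.toℚᵘ-injective (ℚᵘ.≃-trans (toℚᵘ-/ i b) (ℚᵘ.≃-trans eq (ℚᵘ.≃-sym (toℚᵘ-/ j d))))

+/-cross : ∀ x y b d .{{_ : NonZero b}} .{{_ : NonZero d}} → x * d ≡ y * b → + x / b ≡ + y / d
+/-cross x y b@(suc _) d@(suc _) eq = ≃ᵘ⇒/≡/ (+ x) (+ y) b d (*≡* (begin
  + x ℤ.* + d   ≡⟨ ℤ.pos-* x d ⟨
  + (x * d)     ≡⟨ cong +_ eq ⟩
  + (y * b)     ≡⟨ ℤ.pos-* y b ⟩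
  + y ℤ.* + b   ∎))
  where open ≡-Reasoning

+/*+/ : ∀ x y b d .{{_ : NonZero b}} .{{_ : NonZero d}} →
        (+ x / b) ℚ.* (+ y / d) ≡ (+ (x * y) / (b * d)) {{m*n≢0 b d}}
+/*+/ x y b@(suc _) d@(suc _) = ℚ.toℚᵘ-injective (begin
  ℚ.toℚᵘ ((+ x / b) ℚ.* (+ y / d))           ≈⟨ ℚ.toℚᵘ-homo-* (+ x / b) (+ y / d) ⟩
  ℚ.toℚᵘ (+ x / b) ℚᵘ.* ℚ.toℚᵘ (+ y / d)     ≈⟨ ℚᵘ.*-cong (toℚᵘ-/ (+ x) b) (toℚᵘ-/ (+ y) d) ⟩
  (+ x /ᵘ b) ℚᵘ.* (+ y /ᵘ d)                 ≈⟨ ℚᵘ.≃-reflexive (cong (_/ᵘ (b * d)) (sym (ℤ.pos-* x y))) ⟩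
  (+ (x * y) /ᵘ (b * d))                     ≈⟨ ℚᵘ.≃-sym (toℚᵘ-/ (+ (x * y)) (b * d)) ⟩
  ℚ.toℚᵘ (+ (x * y) / (b * d))               ∎)
  where open ℚᵘ.≃-Reasoning

+/++/ : ∀ x y b d .{{_ : NonZero b}} .{{_ : NonZero d}} →
        (+ x / b) ℚ.+ (+ y / d) ≡ (+ (x * d + y * b) / (b * d)) {{m*n≢0 b d}}
+/++/ x y b@(suc _) d@(suc _) = ℚ.toℚᵘ-injective (begin
  ℚ.toℚᵘ ((+ x / b) ℚ.+ (+ y / d))           ≈⟨ ℚ.toℚᵘ-homo-+ (+ x / b) (+ y / d) ⟩
  ℚ.toℚᵘ (+ x / b) ℚᵘ.+ ℚ.toℚᵘ (+ y / d)     ≈⟨ ℚᵘ.+-cong (toℚᵘ-/ (+ x) b) (toℚᵘ-/ (+ y) d) ⟩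
  (+ x /ᵘ b) ℚᵘ.+ (+ y /ᵘ d)                 ≈⟨ ℚᵘ.≃-reflexive (cong (_/ᵘ (b * d)) numerator) ⟩
  (+ (x * d + y * b) /ᵘ (b * d))             ≈⟨ ℚᵘ.≃-sym (toℚᵘ-/ (+ (x * d + y * b)) (b * d)) ⟩
  ℚ.toℚᵘ (+ (x * d + y * b) / (b * d))       ∎)
  where
  open ℚᵘ.≃-Reasoning
  numerator : + x ℤ.* + d ℤ.+ + y ℤ.* + b ≡ + (x * d + y * b)
  numerator = sym (trans (ℤ.pos-+ (x * d) (y * b)) (cong₂ ℤ._+_ (ℤ.pos-* x d) (ℤ.pos-* y b)))

[r+q*d]/d≡q : ∀ r q d .{{_ : NonZero d}} → r < d → (r + q * d) ℕ./ d ≡ q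
[r+q*d]/d≡q r q d r<d = begin
  (r + q * d) ℕ./ d        ≡⟨ +-distrib-/-∣ʳ r (n∣m*n q) ⟩
  r ℕ./ d + q * d ℕ./ d    ≡⟨ cong₂ _+_ (m<n⇒m/n≡0 r<d) (m*n/n≡m q d) ⟩
  q                        ∎
  where open ≡-Reasoning

m*q≡n*p⇒m/p≡n/q : ∀ m n p q .{{_ : NonZero p}} .{{_ : NonZero q}} → m * q ≡ n * p → m ℕ./ p ≡ n ℕ./ q
m*q≡n*p⇒m/p≡n/q m n p q eq = begin
  m ℕ./ p                    ≡⟨ m*n/o*n≡m/o m q p ⟨
  (m * q) ℕ./ (p * q)        ≡⟨ /-congˡ {o = p * q} eq ⟩
  (n * p) ℕ./ (p * q)        ≡⟨ /-congʳ (*-comm p q) ⟩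
  (n * p) ℕ./ (q * p)        ≡⟨ m*n/o*n≡m/o n p q ⟩
  n ℕ./ q                    ∎
  where
  open ≡-Reasoning
  instance
    _ = m*n≢0 p q
    _ = m*n≢0 q p

floor-+/ : ∀ x b .{{_ : NonZero b}} → ℚ.floor (+ x / b) ≡ + (x ℕ./ b)
floor-+/ x b@(suc _) with + x / b in eq | toℚᵘ-/ (+ x) b
... | mkℚ (+ u) d-1 _ | *≡* u*b≡x*d = trans (ℤ.*-identityˡ _)
  (cong +_ (m*q≡n*p⇒m/p≡n/q u x (suc d-1) b (ℤ.+-injective (begin
    + (u * b)            ≡⟨ ℤ.pos-* u b ⟩
    + u ℤ.* + b          ≡⟨ u*b≡x*d ⟩
    + x ℤ.* + suc d-1    ≡⟨ ℤ.pos-* x (suc d-1) ⟨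
    + (x * suc d-1)      ∎))))
  where open ≡-Reasoning
... | mkℚ ℤ.-[1+ _ ] _ _ | _ = ⊥-elim (ℤ.NonNegative.nonNeg (subst ℚ.NonNegative eq (ℚ.normalize-nonNeg x b)))

dyadic : ℕ → ℕ → ℚ
dyadic a e = (+ a / 2 ^ e) {{m^n≢0 2 e}}

dyadic-zero : ∀ e → dyadic 0 e ≡ ℚ.0ℚ
dyadic-zero e = +/-cross 0 0 (2 ^ e) 1 {{m^n≢0 2 e}} refl

pow2-neg : ∀ e → pow2 (ℤ.- (+ e)) ≡ dyadic 1 e
pow2-neg zero    = refl
pow2-neg (suc e) = refl

+/1*dyadic : ∀ m a e → (+ m / 1) ℚ.* dyadic a e ≡ dyadic (m * a) e
+/1*dyadic m a e = trans (+/*+/ m a 1 (2 ^ e) {{_}} {{m^n≢0 2 e}})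
  (+/-cross (m * a) (m * a) (1 * 2 ^ e) (2 ^ e) {{m*n≢0 1 (2 ^ e) {{_}} {{m^n≢0 2 e}}}} {{m^n≢0 2 e}}
    (cong (m * a *_) (sym (*-identityˡ (2 ^ e)))))

dyadic-scale : ∀ a e m → dyadic a e ≡ dyadic (a * 2 ^ m) (e + m)
dyadic-scale a e m = +/-cross a (a * 2 ^ m) (2 ^ e) (2 ^ (e + m)) {{m^n≢0 2 e}} {{m^n≢0 2 (e + m)}} (begin
  a * 2 ^ (e + m)        ≡⟨ cong (a *_) (^-distribˡ-+-* 2 e m) ⟩
  a * (2 ^ e * 2 ^ m)    ≡⟨ cong (a *_) (*-comm (2 ^ e) (2 ^ m)) ⟩
  a * (2 ^ m * 2 ^ e)    ≡⟨ *-assoc a (2 ^ m) (2 ^ e) ⟨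
  a * 2 ^ m * 2 ^ e      ∎)
  where open ≡-Reasoning

dyadic-+-ulp : ∀ a e → dyadic a e ℚ.+ pow2 (ℤ.- (+ e)) ≡ dyadic (suc a) e
dyadic-+-ulp a e = begin
  dyadic a e ℚ.+ pow2 (ℤ.- (+ e))  ≡⟨ cong (dyadic a e ℚ.+_) (pow2-neg e) ⟩
  dyadic a e ℚ.+ dyadic 1 e        ≡⟨ +/++/ a 1 (2 ^ e) (2 ^ e) ⟩
  _                                ≡⟨ +/-cross (a * 2 ^ e + 1 * 2 ^ e) (suc a) (2 ^ e * 2 ^ e) (2 ^ e)
                                           {{m*n≢0 (2 ^ e) (2 ^ e)}} (cross a (2 ^ e)) ⟩
  dyadic (suc a) e                 ∎
  where
  open ≡-Reasoning
  instance _ = m^n≢0 2 e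
  cross : ∀ a T → (a * T + 1 * T) * T ≡ suc a * (T * T)
  cross = solve-∀

+/1*pow2-neg : ∀ m e → (+ m / 1) ℚ.* pow2 (ℤ.- (+ e)) ≡ dyadic m e
+/1*pow2-neg m e = begin
  (+ m / 1) ℚ.* pow2 (ℤ.- (+ e))  ≡⟨ cong ((+ m / 1) ℚ.*_) (pow2-neg e) ⟩
  (+ m / 1) ℚ.* dyadic 1 e        ≡⟨ +/1*dyadic m 1 e ⟩
  dyadic (m * 1) e                ≡⟨ cong (λ a → dyadic a e) (*-identityʳ m) ⟩
  dyadic m e                      ∎
  where open ≡-Reasoning

bit : ℕ → ℕ → ℕ
bit a j = (a ℕ./ 2 ^ j) {{m^n≢0 2 j}} % 2

bit-zero : ∀ a → bit a 0 ≡ a % 2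
bit-zero a = cong (_% 2) (n/1≡n a)

bit-suc : ∀ a j → bit a (suc j) ≡ bit (a ℕ./ 2) j
bit-suc a j = cong (_% 2) (sym (m/n/o≡m/[n*o] a 2 (2 ^ j) {{_}} {{m^n≢0 2 j}} {{m^n≢0 2 (suc j)}}))

bit-zero-+*2 : ∀ b m → bit (b + m * 2) 0 ≡ b % 2
bit-zero-+*2 b m = trans (bit-zero (b + m * 2)) ([m+kn]%n≡m%n b m 2)

bit-suc-+*2 : ∀ b m j → b < 2 → bit (b + m * 2) (suc j) ≡ bit m j
bit-suc-+*2 b m j b<2 = trans (bit-suc (b + m * 2) j) (cong (λ a → bit a j) ([r+q*d]/d≡q b m 2 b<2))

ones : ℕ → ℕ
ones zero    = 0
ones (suc n) = 1 + ones n * 2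

suc-ones : ∀ n → suc (ones n) ≡ 2 ^ n
suc-ones zero    = refl
suc-ones (suc n) = trans (cong (_* 2) (suc-ones n)) (*-comm (2 ^ n) 2)

bit-ones : ∀ {n j} → j < n → bit (ones n) j ≡ 1
bit-ones {suc n} {zero}  _         = bit-zero-+*2 1 (ones n)
bit-ones {suc n} {suc j} (s≤s j<n) = trans (bit-suc-+*2 1 (ones n) j (s≤s (s≤s z≤n))) (bit-ones j<n)

ones-≤ : ∀ n q → (∀ j → j < n → bit q j ≡ 1) → ones n ≤ q
ones-≤ zero    q _    = z≤n
ones-≤ (suc n) q bits = begin
  1 + ones n * 2        ≤⟨ s≤s (*-monoˡ-≤ 2 (ones-≤ n (q ℕ./ 2) bits/2)) ⟩
  1 + q ℕ./ 2 * 2       ≡⟨ cong (_+ q ℕ./ 2 * 2) q%2≡1 ⟨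
  q % 2 + q ℕ./ 2 * 2   ≡⟨ m≡m%n+[m/n]*n q 2 ⟨
  q                     ∎
  where
  open ≤-Reasoning
  q%2≡1 : q % 2 ≡ 1
  q%2≡1 = trans (sym (bit-zero q)) (bits 0 (s≤s z≤n))
  bits/2 : ∀ j → j < n → bit (q ℕ./ 2) j ≡ 1
  bits/2 j j<n = trans (sym (bit-suc q j)) (bits (suc j) (s≤s j<n))

-- In binary: r, then a zero, then v ones; adding 1 flips exactly the bits 0, ..., v.
carryChain : ℕ → ℕ → ℕ
carryChain v r = ones v + r * 2 ^ suc v

carryChain-suc : ∀ v r → carryChain (suc v) r ≡ 1 + carryChain v r * 2
carryChain-suc v r = shape (ones v) r (2 ^ suc v)
  where
  shape : ∀ o r T → 1 + o * 2 + r * (2 * T) ≡ 1 + (o + r * T) * 2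
  shape = solve-∀

bit-carryChain : ∀ v r → bit (carryChain v r) v ≡ 0
bit-carryChain zero    r = bit-zero-+*2 0 r
bit-carryChain (suc v) r = begin
  bit (carryChain (suc v) r) (suc v)       ≡⟨ cong (λ a → bit a (suc v)) (carryChain-suc v r) ⟩
  bit (1 + carryChain v r * 2) (suc v)     ≡⟨ bit-suc-+*2 1 (carryChain v r) v (s≤s (s≤s z≤n)) ⟩
  bit (carryChain v r) v                   ≡⟨ bit-carryChain v r ⟩
  0                                        ∎
  where open ≡-Reasoning

bit-suc-carryChain : ∀ v r → bit (suc (carryChain v r)) v ≡ 1
bit-suc-carryChain zero    r = bit-zero-+*2 1 r
bit-suc-carryChain (suc v) r = begin
  bit (suc (carryChain (suc v) r)) (suc v)      ≡⟨ cong (λ a → bit (suc a) (suc v)) (carryChain-suc v r) ⟩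
  bit (0 + suc (carryChain v r) * 2) (suc v)    ≡⟨ bit-suc-+*2 0 (suc (carryChain v r)) v (s≤s z≤n) ⟩
  bit (suc (carryChain v r)) v                  ≡⟨ bit-suc-carryChain v r ⟩
  1                                             ∎
  where open ≡-Reasoning

bit-carryChain-high : ∀ v r j → v < j → bit (carryChain v r) j ≡ bit (suc (carryChain v r)) j
bit-carryChain-high zero    r (suc j) _ =
  trans (bit-suc-+*2 0 r j (s≤s z≤n)) (sym (bit-suc-+*2 1 r j (s≤s (s≤s z≤n))))
bit-carryChain-high (suc v) r (suc j) (s≤s v<j) = begin
  bit (carryChain (suc v) r) (suc j)            ≡⟨ cong (λ a → bit a (suc j)) (carryChain-suc v r) ⟩
  bit (1 + carryChain v r * 2) (suc j)          ≡⟨ bit-suc-+*2 1 (carryChain v r) j (s≤s (s≤s z≤n)) ⟩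
  bit (carryChain v r) j                        ≡⟨ bit-carryChain-high v r j v<j ⟩
  bit (suc (carryChain v r)) j                  ≡⟨ bit-suc-+*2 0 (suc (carryChain v r)) j (s≤s z≤n) ⟨
  bit (0 + suc (carryChain v r) * 2) (suc j)    ≡⟨ cong (λ a → bit (suc a) (suc j)) (carryChain-suc v r) ⟨
  bit (suc (carryChain (suc v) r)) (suc j)      ∎
  where open ≡-Reasoning

digit-dyadic : ∀ a {t i} → i ≤ t → digit (dyadic a t) i ≡ bit a (t ∸ i)
digit-dyadic a {t} {i} i≤t = cong (ℤ._%ℕ 2) (begin
  ℚ.floor (pow2 (+ i) ℚ.* dyadic a t)     ≡⟨ cong ℚ.floor (+/1*dyadic (2 ^ i) a t) ⟩
  ℚ.floor (dyadic (2 ^ i * a) t)          ≡⟨ floor-+/ (2 ^ i * a) (2 ^ t) ⟩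
  + ((2 ^ i * a) ℕ./ 2 ^ t)               ≡⟨ cong +_ (/-congʳ 2^t≡2^i*2^[t∸i]) ⟩
  + ((2 ^ i * a) ℕ./ (2 ^ i * 2 ^ (t ∸ i))) ≡⟨ cong +_ (m*n/m*o≡n/o (2 ^ i) a (2 ^ (t ∸ i))) ⟩
  + (a ℕ./ 2 ^ (t ∸ i))                   ∎)
  where
  open ≡-Reasoning
  instance
    _ = m^n≢0 2 t
    _ = m^n≢0 2 (t ∸ i)
    _ = m*n≢0 (2 ^ i) (2 ^ (t ∸ i)) {{m^n≢0 2 i}}
  2^t≡2^i*2^[t∸i] : 2 ^ t ≡ 2 ^ i * 2 ^ (t ∸ i)
  2^t≡2^i*2^[t∸i] = trans (cong (2 ^_) (sym (m+[n∸m]≡n i≤t))) (^-distribˡ-+-* 2 i (t ∸ i))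

digit-dyadic-window : ∀ {n t q} → n ≤ t → (∀ j → j < n → bit q j ≡ 1) →
                      ∀ i → t ∸ n < i → i ≤ t → digit (dyadic q t) i ≡ 1
digit-dyadic-window {n} {t} {q} n≤t bits i t∸n<i i≤t =
  trans (digit-dyadic q i≤t) (bits (t ∸ i) t∸i<n)
  where
  t∸i<n : t ∸ i < n
  t∸i<n = subst (t ∸ i <_) (m∸[m∸n]≡n n≤t) (∸-monoʳ-< t∸n<i i≤t)

bits-dyadic-window : ∀ {n t q} → n ≤ t →
                     (∀ i → 1 ≤ i → t ∸ n < i → i ≤ t → digit (dyadic q t) i ≡ 1) →
                     ∀ j → j < n → bit q j ≡ 1
bits-dyadic-window {n} {t} {q} n≤t digits j j<n = begin
  bit q j                     ≡⟨ cong (bit q) (m∸[m∸n]≡n j≤t) ⟨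
  bit q (t ∸ (t ∸ j))         ≡⟨ digit-dyadic q (m∸n≤m t j) ⟨
  digit (dyadic q t) (t ∸ j)  ≡⟨ digits (t ∸ j) (≤-trans (s≤s z≤n) t∸n<t∸j) t∸n<t∸j (m∸n≤m t j) ⟩
  1                           ∎
  where
  open ≡-Reasoning
  j≤t : j ≤ t
  j≤t = ≤-trans (<⇒≤ j<n) n≤t
  t∸n<t∸j : t ∸ n < t ∸ j
  t∸n<t∸j = ∸-monoʳ-< j<n n≤t

leftmostDiff-first : ∀ x y t lo m {p} → lo ≤ p → p < lo + m →
                     (∀ i → lo ≤ i → i < p → digit x i ≡ digit y i) → ¬ digit x p ≡ digit y p →
                     leftmostDiff x y t lo m ≡ p
leftmostDiff-first x y t lo zero {p} lo≤p p<lo+0 _ _ =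
  ⊥-elim (<⇒≱ p<lo+0 (subst (_≤ p) (sym (+-identityʳ lo)) lo≤p))
leftmostDiff-first x y t lo (suc m) {p} lo≤p p<lo+m agree differ =
  scan (digit x lo ℕ.≟ digit y lo) (m≤n⇒m<n∨m≡n lo≤p)
  where
  scan : (d : Dec (digit x lo ≡ digit y lo)) → lo < p ⊎ lo ≡ p →
         (if does d then leftmostDiff x y t (suc lo) m else lo) ≡ p
  scan (yes _)   (inj₁ lo<p) = leftmostDiff-first x y t (suc lo) m lo<p (subst (p <_) (+-suc lo m) p<lo+m)
                                 (λ i lo<i → agree i (<⇒≤ lo<i)) differ
  scan (yes lo≈) (inj₂ refl) = ⊥-elim (differ lo≈)
  scan (no lo≉)  (inj₁ lo<p) = ⊥-elim (lo≉ (agree lo ≤-refl lo<p))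
  scan (no _)    (inj₂ lo≡p) = lo≡p

leftmostChange-carryChain : ∀ v r {t} → v < t →
  leftmostChange (dyadic (carryChain v r) t) (dyadic (suc (carryChain v r)) t) t ≡ t ∸ v
leftmostChange-carryChain v r {t} v<t =
  leftmostDiff-first _ _ t 1 t (m<n⇒0<n∸m v<t) (s≤s (m∸n≤m t v)) agree differ
  where
  a : ℕ
  a = carryChain v r
  t∸[t∸v]≡v : t ∸ (t ∸ v) ≡ v
  t∸[t∸v]≡v = m∸[m∸n]≡n (<⇒≤ v<t)
  agree : ∀ i → 1 ≤ i → i < t ∸ v → digit (dyadic a t) i ≡ digit (dyadic (suc a) t) i
  agree i _ i<t∸v = begin
    digit (dyadic a t) i        ≡⟨ digit-dyadic a i≤t ⟩
    bit a (t ∸ i)               ≡⟨ bit-carryChain-high v r (t ∸ i) v<t∸i ⟩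
    bit (suc a) (t ∸ i)         ≡⟨ digit-dyadic (suc a) i≤t ⟨
    digit (dyadic (suc a) t) i  ∎
    where
    open ≡-Reasoning
    i≤t : i ≤ t
    i≤t = ≤-trans (<⇒≤ i<t∸v) (m∸n≤m t v)
    v<t∸i : v < t ∸ i
    v<t∸i = ∸-cancelʳ-< (subst (_< t ∸ v) (sym (m∸[m∸n]≡n i≤t)) i<t∸v)
  differ : ¬ digit (dyadic a t) (t ∸ v) ≡ digit (dyadic (suc a) t) (t ∸ v)
  differ same = 0≢1+n (begin
    0                                  ≡⟨ bit-carryChain v r ⟨
    bit a v                            ≡⟨ cong (bit a) t∸[t∸v]≡v ⟨
    bit a (t ∸ (t ∸ v))                ≡⟨ digit-dyadic a (m∸n≤m t v) ⟨
    digit (dyadic a t) (t ∸ v)         ≡⟨ same ⟩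
    digit (dyadic (suc a) t) (t ∸ v)   ≡⟨ digit-dyadic (suc a) (m∸n≤m t v) ⟩
    bit (suc a) (t ∸ (t ∸ v))          ≡⟨ cong (bit (suc a)) t∸[t∸v]≡v ⟩
    bit (suc a) v                      ≡⟨ bit-suc-carryChain v r ⟩
    1                                  ∎)
    where open ≡-Reasoning

bumpγ-dyadic : ∀ P v {G} → 2 ^ v ∣ G → bumpγ (+ P) (dyadic G (P + v)) ≡ dyadic (G + 2 ^ v) (P + v)
bumpγ-dyadic P v (divides-refl g) = begin
  ((ℚ.floor (pow2 (+ P) ℚ.* dyadic (g * 2 ^ v) (P + v)) ℤ.+ + 1) / 1) ℚ.* pow2 (ℤ.- (+ P))
      ≡⟨ cong (λ z → ((z ℤ.+ + 1) / 1) ℚ.* pow2 (ℤ.- (+ P))) floor≡g ⟩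
  (+ (g + 1) / 1) ℚ.* pow2 (ℤ.- (+ P))     ≡⟨ cong ((+ (g + 1) / 1) ℚ.*_) (pow2-neg P) ⟩
  (+ (g + 1) / 1) ℚ.* dyadic 1 P           ≡⟨ +/1*dyadic (g + 1) 1 P ⟩
  dyadic ((g + 1) * 1) P                   ≡⟨ dyadic-scale ((g + 1) * 1) P v ⟩
  dyadic ((g + 1) * 1 * 2 ^ v) (P + v)     ≡⟨ cong (λ G → dyadic G (P + v)) (carry g (2 ^ v)) ⟩
  dyadic (g * 2 ^ v + 2 ^ v) (P + v)       ∎
  where
  open ≡-Reasoning
  instance _ = m^n≢0 2 (P + v)
  carry : ∀ g T → (g + 1) * 1 * T ≡ g * T + T
  carry = solve-∀
  floor≡g : ℚ.floor (pow2 (+ P) ℚ.* dyadic (g * 2 ^ v) (P + v)) ≡ + g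
  floor≡g = begin
    ℚ.floor (pow2 (+ P) ℚ.* dyadic (g * 2 ^ v) (P + v))  ≡⟨ cong ℚ.floor (+/1*dyadic (2 ^ P) (g * 2 ^ v) (P + v)) ⟩
    ℚ.floor (dyadic (2 ^ P * (g * 2 ^ v)) (P + v))       ≡⟨ floor-+/ (2 ^ P * (g * 2 ^ v)) (2 ^ (P + v)) ⟩
    + ((2 ^ P * (g * 2 ^ v)) ℕ./ 2 ^ (P + v))            ≡⟨ cong +_ (/-congˡ {o = 2 ^ (P + v)} numerator) ⟩
    + ((g * 2 ^ (P + v)) ℕ./ 2 ^ (P + v))                ≡⟨ cong +_ (m*n/n≡m g (2 ^ (P + v))) ⟩
    + g                                                  ∎
    where
    numerator : 2 ^ P * (g * 2 ^ v) ≡ g * 2 ^ (P + v)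
    numerator = trans (reorder (2 ^ P) g (2 ^ v)) (cong (g *_) (sym (^-distribˡ-+-* 2 P v)))
      where
      reorder : ∀ A g B → A * (g * B) ≡ g * (A * B)
      reorder = solve-∀

double : ℕ → ℕ
double zero    = zero
double (suc q) = suc (suc (double q))

isEven-double : ∀ q → isEven (double q) ≡ true
isEven-double zero    = refl
isEven-double (suc q) = isEven-double q

isEven-suc-double : ∀ q → isEven (suc (double q)) ≡ false
isEven-suc-double zero    = refl
isEven-suc-double (suc q) = isEven-suc-double q

double-or-suc-double : ∀ s → ∃[ q ] (s ≡ double q ⊎ s ≡ suc (double q))
double-or-suc-double zero = 0 , inj₁ refl
double-or-suc-double (suc s) with double-or-suc-double s
... | q , inj₁ refl = q , inj₂ refl
... | q , inj₂ refl = suc q , inj₁ refl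

double-cancel-< : ∀ {p q} → double p < double q → p < q
double-cancel-< {zero}  {suc q} _                 = s≤s z≤n
double-cancel-< {suc p} {suc q} (s≤s (s≤s 2p<2q)) = s≤s (double-cancel-< 2p<2q)

module _ (h : ℕ → ℤ) (t : ℕ) where

  private
    LR : ℕ → State
    LR = loadRun h t

  γ-after-load : ℚ → ℚ → ℚ
  γ-after-load x = bumpγ (h (leftmostChange x (x ℚ.+ pow2 (ℤ.- (+ t))) t))

  loadRun-even : ∀ s → isEven s ≡ true →
    LR (suc s) ≡ ⟨ α (LR s) ℚ.+ pow2 (ℤ.- (+ t)) , β (LR s) , γ-after-load (α (LR s)) (γ (LR s)) ⟩
  loadRun-even s even rewrite even = refl

  loadRun-odd : ∀ s → isEven s ≡ false →
    LR (suc s) ≡ ⟨ α (LR s) , β (LR s) ℚ.+ pow2 (ℤ.- (+ t)) , γ-after-load (β (LR s)) (γ (LR s)) ⟩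
  loadRun-odd s odd rewrite odd = refl

  αβ-double : ∀ q → α (LR (double q)) ≡ dyadic q t × β (LR (double q)) ≡ dyadic q t
  αβ-suc-double : ∀ q → α (LR (suc (double q))) ≡ dyadic (suc q) t × β (LR (suc (double q))) ≡ dyadic q t

  αβ-double zero    = sym (dyadic-zero t) , sym (dyadic-zero t)
  αβ-double (suc q) with αβ-suc-double q
  ... | α≡ , β≡ =
    trans (cong α (loadRun-odd (suc (double q)) (isEven-suc-double q))) α≡ ,
    trans (cong β (loadRun-odd (suc (double q)) (isEven-suc-double q)))
          (trans (cong (ℚ._+ pow2 (ℤ.- (+ t))) β≡) (dyadic-+-ulp q t))

  αβ-suc-double q with αβ-double q
  ... | α≡ , β≡ =
    trans (cong α (loadRun-even (double q) (isEven-double q)))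
          (trans (cong (ℚ._+ pow2 (ℤ.- (+ t))) α≡) (dyadic-+-ulp q t)) ,
    trans (cong β (loadRun-even (double q) (isEven-double q))) β≡

  γ-double-suc : ∀ q →
    γ (LR (double (suc q))) ≡ γ-after-load (dyadic q t) (γ-after-load (dyadic q t) (γ (LR (double q))))
  γ-double-suc q = begin
    γ (LR (double (suc q)))
      ≡⟨ cong γ (loadRun-odd (suc (double q)) (isEven-suc-double q)) ⟩
    γ-after-load (β (LR (suc (double q)))) (γ (LR (suc (double q))))
      ≡⟨ cong₂ γ-after-load (proj₂ (αβ-suc-double q)) (cong γ (loadRun-even (double q) (isEven-double q))) ⟩
    γ-after-load (dyadic q t) (γ-after-load (α (LR (double q))) (γ (LR (double q))))
      ≡⟨ cong (λ x → γ-after-load (dyadic q t) (γ-after-load x (γ (LR (double q))))) (proj₁ (αβ-double q)) ⟩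
    γ-after-load (dyadic q t) (γ-after-load (dyadic q t) (γ (LR (double q))))  ∎
    where open ≡-Reasoning

  β-loadRun : ∀ s → ∃[ q ] double q ≤ s × β (LR s) ≡ dyadic q t
  β-loadRun s with double-or-suc-double s
  ... | q , inj₁ refl = q , ≤-refl , proj₂ (αβ-double q)
  ... | q , inj₂ refl = q , n≤1+n _ , proj₂ (αβ-suc-double q)

module LoadProcess (c : ℤ) (n k D : ℕ) (k+c≡D : + k ℤ.+ c ≡ + D) where

  h : ℕ → ℤ
  h x = + x ℤ.+ c

  t E : ℕ
  t = k + n
  E = D + n

  private
    LR : ℕ → State
    LR = loadRun h t

  h[t∸v] : ∀ {v} → v ≤ n → h (t ∸ v) ≡ + (D + (n ∸ v))
  h[t∸v] {v} v≤n = begin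
    + (k + n ∸ v) ℤ.+ c             ≡⟨ cong (λ x → + x ℤ.+ c) (+-∸-assoc k v≤n) ⟩
    + (k + (n ∸ v)) ℤ.+ c           ≡⟨ cong (ℤ._+ c) (ℤ.pos-+ k (n ∸ v)) ⟩
    + k ℤ.+ + (n ∸ v) ℤ.+ c         ≡⟨ swap (+ k) (+ (n ∸ v)) c ⟩
    + k ℤ.+ c ℤ.+ + (n ∸ v)         ≡⟨ cong (ℤ._+ + (n ∸ v)) k+c≡D ⟩
    + D ℤ.+ + (n ∸ v)               ≡⟨ ℤ.pos-+ D (n ∸ v) ⟨
    + (D + (n ∸ v))                 ∎
    where
    open ≡-Reasoning
    swap : ∀ x y z → x ℤ.+ y ℤ.+ z ≡ x ℤ.+ z ℤ.+ y
    swap = ℤ-Solver.solve-∀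

  γ-after-load-carryChain : ∀ {v r G} → v < n → 2 ^ v ∣ G →
    γ-after-load h t (dyadic (carryChain v r) t) (dyadic G E) ≡ dyadic (G + 2 ^ v) E
  γ-after-load-carryChain {v} {r} {G} v<n 2^v∣G = begin
    bumpγ (h (leftmostChange (dyadic a t) (dyadic a t ℚ.+ pow2 (ℤ.- (+ t))) t)) (dyadic G E)
      ≡⟨ cong (λ x → bumpγ (h (leftmostChange (dyadic a t) x t)) (dyadic G E)) (dyadic-+-ulp a t) ⟩
    bumpγ (h (leftmostChange (dyadic a t) (dyadic (suc a) t) t)) (dyadic G E)
      ≡⟨ cong (λ p → bumpγ (h p) (dyadic G E)) (leftmostChange-carryChain v r v<t) ⟩
    bumpγ (h (t ∸ v)) (dyadic G E)
      ≡⟨ cong₂ bumpγ (h[t∸v] (<⇒≤ v<n)) (cong (dyadic G) E≡P+v) ⟩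
    bumpγ (+ P) (dyadic G (P + v))
      ≡⟨ bumpγ-dyadic P v 2^v∣G ⟩
    dyadic (G + 2 ^ v) (P + v)
      ≡⟨ cong (dyadic (G + 2 ^ v)) E≡P+v ⟨
    dyadic (G + 2 ^ v) E  ∎
    where
    open ≡-Reasoning
    a P : ℕ
    a = carryChain v r
    P = D + (n ∸ v)
    v<t : v < t
    v<t = ≤-trans v<n (m≤n+m n k)
    E≡P+v : E ≡ P + v
    E≡P+v = trans (cong (λ m → D + m) (sym (m∸n+n≡m (<⇒≤ v<n)))) (sym (+-assoc D (n ∸ v) v))

  γ-block : ∀ j → j ≤ n → ∀ {b G} → 2 ^ j ∣ b → 2 ^ j ∣ G → γ (LR (double b)) ≡ dyadic G E →
            γ (LR (double (ones j + b))) ≡ dyadic (G + j * 2 ^ j) E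
  γ-block zero _ {G = G} _ _ γ≡ = trans γ≡ (cong (λ G → dyadic G E) (sym (+-identityʳ G)))
  γ-block (suc j) j<n {_} {G} (divides-refl r) 2^1+j∣G γ≡ = begin
    γ (LR (double (ones (suc j) + r * 2 ^ suc j)))  ≡⟨ cong (γ ∘ LR ∘ double) (twoBlocks (ones j) r (2 ^ suc j)) ⟩
    γ (LR (double (ones j + suc a)))                ≡⟨ γ-block j j≤n 2^j∣suc-a 2^j∣G₂ γ-after-double-load ⟩
    dyadic (G₂ + j * 2 ^ j) E                       ≡⟨ cong (λ G → dyadic G E) (gains G j (2 ^ j)) ⟩
    dyadic (G + suc j * 2 ^ suc j) E                ∎
    where
    open ≡-Reasoning
    j≤n : j ≤ n
    j≤n = <⇒≤ j<n
    a G₁ G₂ : ℕ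
    a = carryChain j r
    G₁ = G + j * 2 ^ j
    G₂ = G₁ + 2 ^ j + 2 ^ j
    2^j∣2^1+j : 2 ^ j ∣ 2 ^ suc j
    2^j∣2^1+j = n∣m*n 2
    2^j∣G₁ : 2 ^ j ∣ G₁
    2^j∣G₁ = ∣m∣n⇒∣m+n (∣-trans 2^j∣2^1+j 2^1+j∣G) (n∣m*n j)
    2^j∣G₂ : 2 ^ j ∣ G₂
    2^j∣G₂ = ∣m∣n⇒∣m+n (∣m∣n⇒∣m+n 2^j∣G₁ ∣-refl) ∣-refl
    2^j∣suc-a : 2 ^ j ∣ suc a
    2^j∣suc-a = subst (2 ^ j ∣_) (cong (_+ r * 2 ^ suc j) (sym (suc-ones j)))
                  (∣m∣n⇒∣m+n ∣-refl (∣-trans 2^j∣2^1+j (n∣m*n r)))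
    γ-before-carry : γ (LR (double a)) ≡ dyadic G₁ E
    γ-before-carry = γ-block j j≤n (∣-trans 2^j∣2^1+j (n∣m*n r)) (∣-trans 2^j∣2^1+j 2^1+j∣G) γ≡
    γ-after-double-load : γ (LR (double (suc a))) ≡ dyadic G₂ E
    γ-after-double-load = begin
      γ (LR (double (suc a)))                   ≡⟨ γ-double-suc h t a ⟩
      load (load (γ (LR (double a))))           ≡⟨ cong (load ∘ load) γ-before-carry ⟩
      load (load (dyadic G₁ E))                 ≡⟨ cong load (γ-after-load-carryChain {r = r} j<n 2^j∣G₁) ⟩
      load (dyadic (G₁ + 2 ^ j) E)              ≡⟨ γ-after-load-carryChain {r = r} j<n (∣m∣n⇒∣m+n 2^j∣G₁ ∣-refl) ⟩
      dyadic G₂ E                               ∎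
      where
      load : ℚ → ℚ
      load = γ-after-load h t (dyadic a t)
    twoBlocks : ∀ o r T → 1 + o * 2 + r * T ≡ o + suc (o + r * T)
    twoBlocks = solve-∀
    gains : ∀ G j T → G + j * T + T + T + j * T ≡ G + suc j * (2 * T)
    gains = solve-∀

  γ-end : γ (LR (double (ones n))) ≡ dyadic n D
  γ-end = begin
    γ (LR (double (ones n)))         ≡⟨ cong (γ ∘ LR ∘ double) (+-identityʳ (ones n)) ⟨
    γ (LR (double (ones n + 0)))     ≡⟨ γ-block n ≤-refl ((2 ^ n) ∣0) ((2 ^ n) ∣0) (sym (dyadic-zero E)) ⟩
    dyadic (0 + n * 2 ^ n) E         ≡⟨ dyadic-scale n D n ⟨
    dyadic n D                       ∎
    where open ≡-Reasoning

  n≤t : n ≤ t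
  n≤t = m≤n+m n k

  done-at-end : Done t n (LR (double (ones n)))
  done-at-end i _ t∸n<i i≤t =
    trans (cong (λ x → digit x i) (proj₁ (αβ-double h t (ones n)))) onesDigit ,
    trans (cong (λ x → digit x i) (proj₂ (αβ-double h t (ones n)))) onesDigit
    where
    onesDigit : digit (dyadic (ones n) t) i ≡ 1
    onesDigit = digit-dyadic-window n≤t (λ _ → bit-ones) i t∸n<i i≤t

  not-done-before-end : ∀ s → s < double (ones n) → ¬ Done t n (LR s)
  not-done-before-end s s<end isDone with β-loadRun h t s
  ... | q , 2q≤s , β≡ =
    <⇒≱ (double-cancel-< (≤-<-trans 2q≤s s<end)) (ones-≤ n q (bits-dyadic-window n≤t digitsβ))
    where
    digitsβ : ∀ i → 1 ≤ i → t ∸ n < i → i ≤ t → digit (dyadic q t) i ≡ 1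
    digitsβ i 1≤i t∸n<i i≤t = trans (cong (λ x → digit x i) (sym β≡)) (proj₂ (isDone i 1≤i t∸n<i i≤t))

  loadEndsWith : LoadEndsWith h t n (dyadic n D)
  loadEndsWith = double (ones n) , done-at-end , not-done-before-end , γ-end

lemma3p5 : (c : ℤ) (n k : ℕ) → n > 0 → k > 0 → + 0 ℤ.≤ (+ k) ℤ.+ c →
    LoadEndsWith (λ x → (+ x) ℤ.+ c) (k + n) n
      (((+ n) / 1) ℚ.* pow2 (ℤ.- ((+ k) ℤ.+ c)))
lemma3p5 c n k _ _ 0≤k+c =
  subst (LoadEndsWith (λ x → + x ℤ.+ c) (k + n) n) (sym limit) (LoadProcess.loadEndsWith c n k D k+c≡D)
  where
  D = ℤ.∣ + k ℤ.+ c ∣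
  k+c≡D : + k ℤ.+ c ≡ + D
  k+c≡D = sym (ℤ.0≤i⇒+∣i∣≡i 0≤k+c)
  limit : (+ n / 1) ℚ.* pow2 (ℤ.- (+ k ℤ.+ c)) ≡ dyadic n D
  limit = trans (cong (λ z → (+ n / 1) ℚ.* pow2 (ℤ.- z)) k+c≡D) (+/1*pow2-neg n D)
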